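{- Let $q\ge p\ge 3$ be coprime integers, let $Q_{\{p,q\}}(x)=\frac{(1-x^{pq})(1-x)}{(1-x^p)(1-x^q)}$ (a polynomial), and let $G(Q_{\{p,q\}})$ be its gapset. Let $k$ be the integer with $F_k<p\le F_{k+1}$, where $(F_n)$ are the Fibonacci numbers $F_1=1$, $F_2=2$, $F_{n+1}=F_n+F_{n-1}$. Then $$k\le \#G(Q_{\{p,q\}})\le p-1,$$ and both estimates are sharp (each bound is attained for some admissible pairs $(p,q)$).
   Context: For a polynomial $f$ with at least two nonzero coefficients, written as $f(x)=c_1x^{e_1}+\dots+c_kx^{e_k}$ with all $c_i\ne0$ and $0\le e_1<\dots<e_k$, its gapset is $G(f)=\{e_{i+1}-e_i\}$. -}

module Defs where

open import Data.Nat as ℕ using (ℕ; zero; suc; _∸_)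
open import Data.Integer as ℤ using (ℤ; +_; -_)
open import Data.List using (List; []; _∷_; _++_; [_]; replicate; map; length; deduplicate)
open import Relation.Binary.PropositionalEquality using (_≡_)
open import Relation.Nullary using (yes; no)

-- Polynomials with integer coefficients: coefficient lists, constant term first.
Poly : Set
Poly = List ℤ

coeff : Poly → ℕ → ℤ
coeff []       _       = + 0
coeff (a ∷ f)  zero    = a
coeff (a ∷ f)  (suc n) = coeff f n

-- polynomial equality (ignores trailing zeros)
_≈ₚ_ : Poly → Poly → Set
f ≈ₚ g = ∀ n → coeff f n ≡ coeff g n

infix 4 _≈ₚ_

addP : Poly → Poly → Poly
addP []      g       = g
addP f       []      = f
addP (a ∷ f) (b ∷ g) = (a ℤ.+ b) ∷ addP f g

negP : Poly → Poly
negP = map (λ a → - a)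

mulP : Poly → Poly → Poly
mulP []      g = []
mulP (a ∷ f) g = addP (map (a ℤ.*_) g) (+ 0 ∷ mulP f g)

xPow : ℕ → Poly
xPow n = replicate n (+ 0) ++ [ + 1 ]

oneMinusXPow : ℕ → Poly
oneMinusXPow n = addP [ + 1 ] (negP (xPow n))

-- Q is the polynomial Q_{p,q} = (1-x^{pq})(1-x) / ((1-x^p)(1-x^q)),
-- characterised by Q * (1-x^p)(1-x^q) = (1-x^{pq})(1-x).
IsQ : ℕ → ℕ → Poly → Set
IsQ p q Q = mulP Q (mulP (oneMinusXPow p) (oneMinusXPow q))
            ≈ₚ mulP (oneMinusXPow (p ℕ.* q)) (oneMinusXPow 1)

expsFrom : ℕ → Poly → List ℕ
expsFrom i []      = []
expsFrom i (a ∷ f) with a ℤ.≟ + 0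
... | yes _ = expsFrom (suc i) f
... | no  _ = i ∷ expsFrom (suc i) f

exps : Poly → List ℕ
exps = expsFrom 0

gaps : List ℕ → List ℕ
gaps []            = []
gaps (e ∷ [])      = []
gaps (e ∷ e' ∷ es) = (e' ∸ e) ∷ gaps (e' ∷ es)

gapset : Poly → List ℕ
gapset f = deduplicate ℕ._≟_ (gaps (exps f))

#G : Poly → ℕ
#G f = length (gapset f)

-- Fibonacci numbers with F_1 = 1, F_2 = 2, F_{n+1} = F_n + F_{n-1}
-- (F_0 = 1, consistent with the recurrence; irrelevant since p ≥ 3)
F : ℕ → ℕ
F zero          = 1
F (suc zero)    = 1
F (suc (suc n)) = F (suc n) ℕ.+ F n

{-# OPTIONS --safe #-}
module Submission where

-- Let S = ⟨p, q⟩ be the numerical semigroup generated by p and q.  Then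
-- Q(x) = (1 − x) Σ_{n ∈ S} xⁿ, so the exponents of Q are the places where membership in S
-- changes, and the gaps of Q are the lengths of the maximal runs of S and of its complement.
-- Since S + p ⊆ S, all these runs are shorter than p, whence #G ≤ p − 1.
-- For the lower bound, run the subtractive Euclidean algorithm from (p, p − q mod p).  The
-- first gap p − 1 separates 0 and p; every later pair (a, b) comes from Farey neighbours
-- l/k < q/p < k′/l′ with kq − lp = a and k′p − l′q = b, and unimodularity (kk′ − ll′ = 1)
-- leaves no element of S strictly between lp and kq, nor between l′q and k′p, so
-- max(a, b) − 1 is a gap.  These maxima strictly decrease, and the Fibonacci bound on the
-- length of the Euclidean algorithm yields at least k of them when F k < p.

open import Defs
open import Data.Nat using (ℕ; suc; _≤_; _<_; _∸_)
open import Data.Nat.Coprimality using (Coprime)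
open import Data.Product using (_×_; Σ-syntax)
open import Relation.Binary.PropositionalEquality using (_≡_)

open import Data.Nat using (zero; _≟_; _≤?_; s≤s; z≤n; z<s)
import Data.Nat as ℕ
import Data.Nat.Properties as ℕ
open import Data.Nat.Coprimality using (gcd≡1⇒coprime)
open import Data.Nat.Divisibility using (_∣_)
open import Data.Integer using (ℤ; +_)
import Data.Integer as ℤ
import Data.Integer.Properties as ℤ
open import Data.Empty using (⊥)
open import Data.Product using (_,_; ∃; ∃₂; proj₁; proj₂)
open import Data.Sum using (_⊎_; inj₁; inj₂; [_,_]′)
open import Data.List using (List; []; _∷_; [_]; map)
open import Data.List.Membership.Propositional using (_∈_)
open import Data.List.Relation.Unary.Any using (here; there)
open import Function.Bundles using (_⇔_; mk⇔; Equivalence)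
open import Relation.Nullary using (Dec; yes; no; does; ¬_)
open import Relation.Binary.PropositionalEquality
  using (_≢_; refl; sym; trans; cong; cong₂; subst; _≗_; module ≡-Reasoning)

module Sequences where

  open import Data.Bool using (if_then_else_)
  open import Data.Nat.Properties using (≤-refl; ≤-trans; m≤n⇒m≤1+n; m+[n∸m]≡n; ≰⇒>; +-comm)
  open import Data.Integer using (_+_; _-_)
  open import Data.Integer.Tactic.RingSolver using (solve-∀)
  open import Relation.Nullary using (contradiction)
  open import Relation.Nullary.Decidable using (dec-true; dec-false)

  𝟙 : ∀ {A : Set} → Dec A → ℤ
  𝟙 a? = if does a? then + 1 else + 0

  𝟙-yes : ∀ {A : Set} (a? : Dec A) → A → 𝟙 a? ≡ + 1
  𝟙-yes a? a rewrite dec-true a? a = refl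

  𝟙-no : ∀ {A : Set} (a? : Dec A) → ¬ A → 𝟙 a? ≡ + 0
  𝟙-no a? ¬a rewrite dec-false a? ¬a = refl

  𝟙-cong : ∀ {A B : Set} (a? : Dec A) (b? : Dec B) → A ⇔ B → 𝟙 a? ≡ 𝟙 b?
  𝟙-cong (yes a) b? A⇔B = sym (𝟙-yes b? (Equivalence.to A⇔B a))
  𝟙-cong (no ¬a) b? A⇔B = sym (𝟙-no b? λ b → ¬a (Equivalence.from A⇔B b))

  𝟙-sub-≡0 : ∀ {A B : Set} (a? : Dec A) (b? : Dec B) → 𝟙 a? - 𝟙 b? ≡ + 0 → A ⇔ B
  𝟙-sub-≡0 (yes a) (yes b) _ = mk⇔ (λ _ → b) (λ _ → a)
  𝟙-sub-≡0 (no ¬a) (no ¬b) _ = mk⇔ (λ a → contradiction a ¬a) (λ b → contradiction b ¬b)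

  𝟙-sub-≢0 : ∀ {A B : Set} (a? : Dec A) (b? : Dec B) → 𝟙 a? - 𝟙 b? ≢ + 0 →
             (A → ¬ B) × (¬ A → B)
  𝟙-sub-≢0 (yes a) (yes b) ≢0 = contradiction refl ≢0
  𝟙-sub-≢0 (yes a) (no ¬b) _  = (λ _ → ¬b) , (λ ¬a → contradiction a ¬a)
  𝟙-sub-≢0 (no ¬a) (yes b) _  = (λ a → contradiction a ¬a) , (λ _ → b)
  𝟙-sub-≢0 (no ¬a) (no ¬b) ≢0 = contradiction refl ≢0

  -- Sequences stand for power series; shift k and Δ k multiply by xᵏ and by 1 − xᵏ.

  Seq : Set
  Seq = ℕ → ℤ

  δ : ℕ → Seq
  δ k n = 𝟙 (n ≟ k)

  shift : ℕ → Seq → Seq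
  shift zero    c n       = c n
  shift (suc k) c zero    = + 0
  shift (suc k) c (suc n) = shift k c n

  Δ : ℕ → Seq → Seq
  Δ k c n = c n - shift k c n

  module _ {c d : Seq} where

    shift-cong : ∀ k → c ≗ d → shift k c ≗ shift k d
    shift-cong zero    c≗d n       = c≗d n
    shift-cong (suc k) c≗d zero    = refl
    shift-cong (suc k) c≗d (suc n) = shift-cong k c≗d n

    shift-local : ∀ k {n} → (∀ m → m ≤ n → c m ≡ d m) → shift k c n ≡ shift k d n
    shift-local zero    {n}     c≡d = c≡d n ≤-refl
    shift-local (suc k) {zero}  c≡d = refl
    shift-local (suc k) {suc n} c≡d = shift-local k λ m m≤n → c≡d m (m≤n⇒m≤1+n m≤n)

    shift-pointwise : (f : ℤ → ℤ → ℤ) → f (+ 0) (+ 0) ≡ + 0 →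
                      ∀ k → shift k (λ m → f (c m) (d m)) ≗ λ n → f (shift k c n) (shift k d n)
    shift-pointwise f f00 zero    n       = refl
    shift-pointwise f f00 (suc k) zero    = sym f00
    shift-pointwise f f00 (suc k) (suc n) = shift-pointwise f f00 k n

  shift-shift : ∀ j k (c : Seq) → shift j (shift k c) ≗ shift (j ℕ.+ k) c
  shift-shift zero    k c n       = refl
  shift-shift (suc j) k c zero    = refl
  shift-shift (suc j) k c (suc n) = shift-shift j k c n

  shift-comm : ∀ j k (c : Seq) → shift j (shift k c) ≗ shift k (shift j c)
  shift-comm j k c n = begin
    shift j (shift k c) n  ≡⟨ shift-shift j k c n ⟩
    shift (j ℕ.+ k) c n    ≡⟨ cong (λ i → shift i c n) (+-comm j k) ⟩
    shift (k ℕ.+ j) c n    ≡⟨ shift-shift k j c n ⟨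
    shift k (shift j c) n  ∎
    where open ≡-Reasoning

  shift-+ : ∀ k (c : Seq) m → shift k c (k ℕ.+ m) ≡ c m
  shift-+ zero    c m = refl
  shift-+ (suc k) c m = shift-+ k c m

  shift-< : ∀ {k n} (c : Seq) → n < k → shift k c n ≡ + 0
  shift-< {suc k} {zero}  c _         = refl
  shift-< {suc k} {suc n} c (s≤s n<k) = shift-< c n<k

  shift-zero : ∀ k → shift k (λ _ → + 0) ≗ λ _ → + 0
  shift-zero zero    n       = refl
  shift-zero (suc k) zero    = refl
  shift-zero (suc k) (suc n) = shift-zero k n

  shift-δ₀ : ∀ k → shift k (δ 0) ≗ δ k
  shift-δ₀ zero    n       = refl
  shift-δ₀ (suc k) zero    = refl
  shift-δ₀ (suc k) (suc n) = shift-δ₀ k n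

  Δ-cong : ∀ k {c d : Seq} → c ≗ d → Δ k c ≗ Δ k d
  Δ-cong k c≗d n = cong₂ _-_ (c≗d n) (shift-cong k c≗d n)

  Δ-Δ : ∀ j k (c : Seq) n →
        Δ j (Δ k c) n ≡ (c n - shift k c n) - (shift j c n - shift (j ℕ.+ k) c n)
  Δ-Δ j k c n = cong (_-_ (c n - shift k c n))
    (trans (shift-pointwise _-_ refl j n) (cong (_-_ (shift j c n)) (shift-shift j k c n)))

  Δ-comm : ∀ j k (c : Seq) → Δ j (Δ k c) ≗ Δ k (Δ j c)
  Δ-comm j k c n = begin
    Δ j (Δ k c) n
      ≡⟨ Δ-Δ j k c n ⟩
    (c n - shift k c n) - (shift j c n - shift (j ℕ.+ k) c n)
      ≡⟨ cong (λ i → (c n - shift k c n) - (shift j c n - shift i c n)) (+-comm j k) ⟩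
    (c n - shift k c n) - (shift j c n - shift (k ℕ.+ j) c n)
      ≡⟨ exchange (c n) (shift k c n) (shift j c n) _ ⟩
    (c n - shift j c n) - (shift k c n - shift (k ℕ.+ j) c n)
      ≡⟨ Δ-Δ k j c n ⟨
    Δ k (Δ j c) n
      ∎
    where
    open ≡-Reasoning
    exchange : ∀ x y z w → (x - y) - (z - w) ≡ (x - z) - (y - w)
    exchange = solve-∀

  Δ-injective : ∀ {k} → 0 < k → ∀ {c d : Seq} → Δ k c ≗ Δ k d → c ≗ d
  Δ-injective {suc k} _ {c} {d} Δc≗Δd n = agree n n ≤-refl
    where
    split : ∀ x y → x ≡ (x - y) + y
    split = solve-∀

    agree   : ∀ n m → m ≤ n → c m ≡ d m
    earlier : ∀ n m → m ≤ n → shift (suc k) c m ≡ shift (suc k) d m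

    agree n m m≤n = begin
      c m                                ≡⟨ split (c m) _ ⟩
      Δ (suc k) c m + shift (suc k) c m  ≡⟨ cong₂ _+_ (Δc≗Δd m) (earlier n m m≤n) ⟩
      Δ (suc k) d m + shift (suc k) d m  ≡⟨ split (d m) _ ⟨
      d m                                ∎
      where open ≡-Reasoning

    earlier n       zero    _         = refl
    earlier (suc n) (suc m) (s≤s m≤n) = shift-local k λ i i≤m → agree n i (≤-trans i≤m m≤n)

  Δ-≗-intro : ∀ k {c d : Seq} → (∀ n → n < k → c n ≡ d n) →
              (∀ m → c (k ℕ.+ m) - c m ≡ d (k ℕ.+ m)) → Δ k c ≗ d
  Δ-≗-intro k {c} {d} below above n with k ≤? n
  ... | yes k≤n = subst (λ n → Δ k c n ≡ d n) (m+[n∸m]≡n k≤n)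
                    (trans (cong (_-_ (c (k ℕ.+ (n ∸ k)))) (shift-+ k c (n ∸ k))) (above (n ∸ k)))
  ... | no  k≰n = trans (cong (_-_ (c n)) (shift-< c (≰⇒> k≰n)))
                        (trans (ℤ.+-identityʳ (c n)) (below n (≰⇒> k≰n)))

open Sequences

module Polynomials where

  open import Data.Integer using (_+_; _-_; _*_; -_)
  open import Data.Integer.Tactic.RingSolver using (solve-∀)

  coeff-addP : ∀ f g → coeff (addP f g) ≗ λ n → coeff f n + coeff g n
  coeff-addP []      g       n       = sym (ℤ.+-identityˡ _)
  coeff-addP (a ∷ f) []      n       = sym (ℤ.+-identityʳ _)
  coeff-addP (a ∷ f) (b ∷ g) zero    = refl
  coeff-addP (a ∷ f) (b ∷ g) (suc n) = coeff-addP f g n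

  coeff-negP : ∀ f → coeff (negP f) ≗ λ n → - coeff f n
  coeff-negP []      n       = refl
  coeff-negP (a ∷ f) zero    = refl
  coeff-negP (a ∷ f) (suc n) = coeff-negP f n

  coeff-map-* : ∀ a f → coeff (map (a *_) f) ≗ λ n → a * coeff f n
  coeff-map-* a []      n       = sym (ℤ.*-zeroʳ a)
  coeff-map-* a (b ∷ f) zero    = refl
  coeff-map-* a (b ∷ f) (suc n) = coeff-map-* a f n

  coeff-∷-0 : ∀ f → coeff (+ 0 ∷ f) ≗ shift 1 (coeff f)
  coeff-∷-0 f zero    = refl
  coeff-∷-0 f (suc n) = refl

  coeff-xPow : ∀ k → coeff (xPow k) ≗ shift k (δ 0)
  coeff-xPow zero    zero    = refl
  coeff-xPow zero    (suc n) = refl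
  coeff-xPow (suc k) n       =
    trans (coeff-∷-0 (xPow k) n) (trans (shift-cong 1 (coeff-xPow k) n) (shift-shift 1 k (δ 0) n))

  coeff-oneMinusXPow : ∀ k → coeff (oneMinusXPow k) ≗ Δ k (δ 0)
  coeff-oneMinusXPow k n = trans (coeff-addP [ + 1 ] (negP (xPow k)) n)
    (cong₂ _+_ (coeff-xPow 0 n) (trans (coeff-negP (xPow k) n) (cong -_ (coeff-xPow k n))))

  infixl 7 _⋆_

  _⋆_ : Poly → Seq → Seq
  ([]      ⋆ c) n = + 0
  ((a ∷ f) ⋆ c) n = a * c n + shift 1 (f ⋆ c) n

  coeff-mulP : ∀ f g → coeff (mulP f g) ≗ f ⋆ coeff g
  coeff-mulP []      g n = refl
  coeff-mulP (a ∷ f) g n = begin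
    coeff (addP (map (a *_) g) (+ 0 ∷ mulP f g)) n     ≡⟨ coeff-addP (map (a *_) g) _ n ⟩
    coeff (map (a *_) g) n + coeff (+ 0 ∷ mulP f g) n  ≡⟨ cong₂ _+_ (coeff-map-* a g n) tail≡ ⟩
    a * coeff g n + shift 1 (f ⋆ coeff g) n             ∎
    where
    open ≡-Reasoning
    tail≡ : coeff (+ 0 ∷ mulP f g) n ≡ shift 1 (f ⋆ coeff g) n
    tail≡ = trans (coeff-∷-0 (mulP f g) n) (shift-cong 1 (coeff-mulP f g) n)

  ⋆-cong : ∀ f {c d : Seq} → c ≗ d → f ⋆ c ≗ f ⋆ d
  ⋆-cong []      c≗d n = refl
  ⋆-cong (a ∷ f) c≗d n = cong₂ (λ x y → a * x + y) (c≗d n) (shift-cong 1 (⋆-cong f c≗d) n)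

  ⋆-δ₀ : ∀ f → f ⋆ δ 0 ≗ coeff f
  ⋆-δ₀ []      n       = refl
  ⋆-δ₀ (a ∷ f) zero    = trans (ℤ.+-identityʳ (a * + 1)) (ℤ.*-identityʳ a)
  ⋆-δ₀ (a ∷ f) (suc n) =
    trans (cong (_+ (f ⋆ δ 0) n) (ℤ.*-zeroʳ a)) (trans (ℤ.+-identityˡ _) (⋆-δ₀ f n))

  ⋆-Δ : ∀ f k (c : Seq) → f ⋆ Δ k c ≗ Δ k (f ⋆ c)
  ⋆-Δ []      k c n = sym (cong (_-_ (+ 0)) (shift-zero k n))
  ⋆-Δ (a ∷ f) k c n = begin
    a * Δ k c n + shift 1 (f ⋆ Δ k c) n
      ≡⟨ cong (_+_ (a * Δ k c n)) (trans (shift-cong 1 (⋆-Δ f k c) n) (shift-pointwise _-_ refl 1 n)) ⟩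
    a * (c n - shift k c n) + (shift 1 (f ⋆ c) n - shift 1 (shift k (f ⋆ c)) n)
      ≡⟨ cong (λ x → a * (c n - shift k c n) + (shift 1 (f ⋆ c) n - x)) (shift-comm 1 k (f ⋆ c) n) ⟩
    a * (c n - shift k c n) + (shift 1 (f ⋆ c) n - shift k (shift 1 (f ⋆ c)) n)
      ≡⟨ regroup a (c n) (shift k c n) (shift 1 (f ⋆ c) n) _ ⟩
    (a * c n + shift 1 (f ⋆ c) n) - (a * shift k c n + shift k (shift 1 (f ⋆ c)) n)
      ≡⟨ cong (_-_ (((a ∷ f) ⋆ c) n)) (shift-pointwise (λ x y → a * x + y) a*0+0≡0 k n) ⟨
    Δ k ((a ∷ f) ⋆ c) n
      ∎
    where
    open ≡-Reasoning
    regroup : ∀ a x y z w → a * (x - y) + (z - w) ≡ (a * x + z) - (a * y + w)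
    regroup = solve-∀
    a*0+0≡0 : a * + 0 + + 0 ≡ + 0
    a*0+0≡0 = trans (ℤ.+-identityʳ _) (ℤ.*-zeroʳ a)

  coeff-mulP-oneMinusXPow : ∀ f k → coeff (mulP f (oneMinusXPow k)) ≗ Δ k (coeff f)
  coeff-mulP-oneMinusXPow f k n = begin
    coeff (mulP f (oneMinusXPow k)) n  ≡⟨ coeff-mulP f _ n ⟩
    (f ⋆ coeff (oneMinusXPow k)) n     ≡⟨ ⋆-cong f (coeff-oneMinusXPow k) n ⟩
    (f ⋆ Δ k (δ 0)) n                  ≡⟨ ⋆-Δ f k (δ 0) n ⟩
    Δ k (f ⋆ δ 0) n                    ≡⟨ Δ-cong k (⋆-δ₀ f) n ⟩
    Δ k (coeff f) n                    ∎
    where open ≡-Reasoning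

  IsQ⇒Δ-coeff : ∀ p q Q → IsQ p q Q → Δ q (Δ p (coeff Q)) ≗ Δ 1 (Δ (p ℕ.* q) (δ 0))
  IsQ⇒Δ-coeff p q Q isQ n = begin
    Δ q (Δ p (coeff Q)) n
      ≡⟨ Δ-cong q (Δ-cong p (⋆-δ₀ Q)) n ⟨
    Δ q (Δ p (Q ⋆ δ 0)) n
      ≡⟨ Δ-cong q (⋆-Δ Q p (δ 0)) n ⟨
    Δ q (Q ⋆ Δ p (δ 0)) n
      ≡⟨ ⋆-Δ Q q (Δ p (δ 0)) n ⟨
    (Q ⋆ Δ q (Δ p (δ 0))) n
      ≡⟨ ⋆-cong Q (Δ-cong q (coeff-oneMinusXPow p)) n ⟨
    (Q ⋆ Δ q (coeff (oneMinusXPow p))) n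
      ≡⟨ ⋆-cong Q (coeff-mulP-oneMinusXPow (oneMinusXPow p) q) n ⟨
    (Q ⋆ coeff (mulP (oneMinusXPow p) (oneMinusXPow q))) n
      ≡⟨ coeff-mulP Q _ n ⟨
    coeff (mulP Q (mulP (oneMinusXPow p) (oneMinusXPow q))) n
      ≡⟨ isQ n ⟩
    coeff (mulP (oneMinusXPow (p ℕ.* q)) (oneMinusXPow 1)) n
      ≡⟨ coeff-mulP-oneMinusXPow (oneMinusXPow (p ℕ.* q)) 1 n ⟩
    Δ 1 (coeff (oneMinusXPow (p ℕ.* q))) n
      ≡⟨ Δ-cong 1 (coeff-oneMinusXPow (p ℕ.* q)) n ⟩
    Δ 1 (Δ (p ℕ.* q) (δ 0)) n
      ∎
    where open ≡-Reasoning

open Polynomials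

infix 4 _∈⟨_,_⟩

_∈⟨_,_⟩ : ℕ → ℕ → ℕ → Set
n ∈⟨ p , q ⟩ = ∃₂ λ i j → i ℕ.* p ℕ.+ j ℕ.* q ≡ n

∈⟨⟩-comm : ∀ {n p q} → n ∈⟨ p , q ⟩ → n ∈⟨ q , p ⟩
∈⟨⟩-comm {p = p} {q} (i , j , eq) = j , i , trans (ℕ.+-comm (j ℕ.* q) (i ℕ.* p)) eq

module NumericalSemigroup (p q : ℕ) .{{_ : ℕ.NonZero p}} .{{_ : ℕ.NonZero q}} where

  open import Data.Nat using (_+_; _*_; pred; _<?_; >-nonZero⁻¹; ≢-nonZero; ≢-nonZero⁻¹)
  open import Data.Nat.Properties
  open import Data.Nat.Divisibility using (divides; _∣?_; ∣⇒≤)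
  open import Data.Nat.Coprimality using (coprime-divisor)
  import Data.Nat.Tactic.RingSolver as ℕ-Solver
  open import Relation.Nullary using (contradiction)
  open import Relation.Nullary.Decidable using (map′; _×-dec_)
  open import Relation.Unary using (Decidable)

  S : ℕ → Set
  S = _∈⟨ p , q ⟩

  S? : Decidable S
  S? n = map′ from-search to-search
           (anyUpTo? (λ j → (j * q ≤? n) ×-dec (p ∣? (n ∸ j * q))) (suc n))
    where
    from-search : (∃ λ j → j < suc n × (j * q ≤ n × p ∣ n ∸ j * q)) → S n
    from-search (j , _ , jq≤n , divides i eq) =
      i , j , trans (cong (_+ j * q) (sym eq)) (m∸n+n≡m jq≤n)
    to-search : S n → ∃ λ j → j < suc n × (j * q ≤ n × p ∣ n ∸ j * q)
    to-search (i , j , eq) =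
      j , s≤s (≤-trans (m≤m*n j q) jq≤n) , jq≤n ,
      divides i (trans (cong (_∸ j * q) (sym eq)) (m+n∸n≡m (i * p) (j * q)))
      where
      jq≤n : j * q ≤ n
      jq≤n = subst (j * q ≤_) eq (m≤n+m (j * q) (i * p))

  s : Seq
  s n = 𝟙 (S? n)

  0∈S : S 0
  0∈S = 0 , 0 , refl

  +p-closed : ∀ {m} → S m → S (p + m)
  +p-closed (i , j , eq) = suc i , j , trans (+-assoc p (i * p) (j * q)) (cong (_+_ p) eq)

  -- The Apéry set of S with respect to p: the least element of S in each residue class mod p.

  Apéry : ℕ → Set
  Apéry n = ∃ λ j → j < p × j * q ≡ n

  Apéry? : Decidable Apéry
  Apéry? n = anyUpTo? (λ j → j * q ≟ n) p

  w : Seq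
  w n = 𝟙 (Apéry? n)

  Apéry⇒S : ∀ {n} → Apéry n → S n
  Apéry⇒S (j , _ , eq) = 0 , j , eq

  S⇒Apéry : ∀ {n} → S n → (∀ m → n ≡ p + m → ¬ S m) → Apéry n
  S⇒Apéry (suc i , j , eq) minimal =
    contradiction (i , j , refl) (minimal _ (trans (sym eq) (+-assoc p (i * p) (j * q))))
  S⇒Apéry {n} (zero , j , eq) minimal with j <? p
  ... | yes j<p = j , j<p , eq
  ... | no  j≮p = contradiction (pred q , j ∸ p , refl) (minimal _ n≡p+⋯)
    where
    expand : ∀ p e r → (p + e) * suc r ≡ p + (r * p + e * suc r)
    expand = ℕ-Solver.solve-∀
    n≡p+⋯ : n ≡ p + (pred q * p + (j ∸ p) * q)
    n≡p+⋯ = begin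
      n                  ≡⟨ eq ⟨
      j * q              ≡⟨ cong (_* q) (m+[n∸m]≡n (≮⇒≥ j≮p)) ⟨
      (p + (j ∸ p)) * q
        ≡⟨ subst (λ x → (p + (j ∸ p)) * x ≡ p + (pred q * p + (j ∸ p) * x))
                 (suc-pred q) (expand p (j ∸ p) (pred q)) ⟩
      p + (pred q * p + (j ∸ p) * q)
        ∎
      where open ≡-Reasoning

  Apéry-minimal : Coprime p q → ∀ {m} → Apéry (p + m) → ¬ S m
  Apéry-minimal coprime {m} (j , j<p , jq≡p+m) (i , j′ , eq) with j ≤? j′
  ... | yes j≤j′ = <-irrefl refl (begin-strict
        j * q            ≤⟨ *-monoˡ-≤ q j≤j′ ⟩
        j′ * q           ≤⟨ m≤n+m (j′ * q) (i * p) ⟩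
        i * p + j′ * q   ≡⟨ eq ⟩
        m                <⟨ m<n+m m (>-nonZero⁻¹ p) ⟩
        p + m            ≡⟨ jq≡p+m ⟨
        j * q            ∎)
    where open ≤-Reasoning
  ... | no j≰j′ = <⇒≱ j<p (≤-trans p≤e (subst (e ≤_) j′+e≡j (m≤n+m e j′)))
    where
    e = j ∸ j′
    j′+e≡j : j′ + e ≡ j
    j′+e≡j = m+[n∸m]≡n (<⇒≤ (≰⇒> j≰j′))
    q*e≡1+i*p : q * e ≡ suc i * p
    q*e≡1+i*p = +-cancelˡ-≡ (j′ * q) _ _ (begin
      j′ * q + q * e        ≡⟨ cong (_+_ (j′ * q)) (*-comm q e) ⟩
      j′ * q + e * q        ≡⟨ *-distribʳ-+ q j′ e ⟨
      (j′ + e) * q          ≡⟨ cong (_* q) j′+e≡j ⟩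
      j * q                 ≡⟨ jq≡p+m ⟩
      p + m                 ≡⟨ cong (_+_ p) eq ⟨
      p + (i * p + j′ * q)  ≡⟨ shuffle p (i * p) (j′ * q) ⟩
      j′ * q + suc i * p    ∎)
      where
      open ≡-Reasoning
      shuffle : ∀ x y z → x + (y + z) ≡ z + (x + y)
      shuffle = ℕ-Solver.solve-∀
    e≢0 : e ≢ 0
    e≢0 e≡0 = j≰j′ (subst (_≤ j′) j′+0≡j ≤-refl)
      where
      j′+0≡j : j′ ≡ j
      j′+0≡j = trans (sym (+-identityʳ j′)) (trans (cong (_+_ j′) (sym e≡0)) j′+e≡j)
    p≤e : p ≤ e
    p≤e = ∣⇒≤ {{≢-nonZero e≢0}} (coprime-divisor coprime (divides (suc i) q*e≡1+i*p))

  q+m≡pq⇒Apéry : ∀ {m} → q + m ≡ p * q → Apéry m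
  q+m≡pq⇒Apéry {m} eq =
    pred p , subst (pred p <_) (suc-pred p) (n<1+n (pred p)) ,
    sym (+-cancelˡ-≡ q m (pred p * q) (trans eq (cong (_* q) (sym (suc-pred p)))))

  Apéry-step⁺ : ∀ {m} → Apéry m → q + m ≢ p * q → Apéry (q + m)
  Apéry-step⁺ (j , j<p , jq≡m) q+m≢pq with m≤n⇒m<n∨m≡n j<p
  ... | inj₁ 1+j<p = suc j , 1+j<p , cong (_+_ q) jq≡m
  ... | inj₂ 1+j≡p = contradiction (trans (cong (_+_ q) (sym jq≡m)) (cong (_* q) 1+j≡p)) q+m≢pq

  Apéry-step⁻ : ∀ {m} → Apéry (q + m) → Apéry m × q + m ≢ p * q
  Apéry-step⁻ {m} (zero , _ , 0≡q+m) = contradiction (m+n≡0⇒m≡0 q (sym 0≡q+m)) (≢-nonZero⁻¹ q)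
  Apéry-step⁻ {m} (suc j , 1+j<p , eq) =
    (j , <-trans (n<1+n j) 1+j<p , +-cancelˡ-≡ q _ _ eq) ,
    λ q+m≡pq → <-irrefl (*-cancelʳ-≡ (suc j) p q (trans eq q+m≡pq)) 1+j<p

  Δp[s]≗w : Coprime p q → Δ p s ≗ w
  Δp[s]≗w coprime = Δ-≗-intro p below above
    where
    below : ∀ n → n < p → s n ≡ w n
    below n n<p = 𝟙-cong (S? n) (Apéry? n) (mk⇔ (λ n∈S → S⇒Apéry n∈S no-predecessor) Apéry⇒S)
      where
      no-predecessor : ∀ m → n ≡ p + m → ¬ S m
      no-predecessor m n≡p+m _ = <⇒≱ n<p (subst (p ≤_) (sym n≡p+m) (m≤m+n p m))
    above : ∀ m → s (p + m) ℤ.- s m ≡ w (p + m)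
    above m with S? m
    ... | yes m∈S = begin
      s (p + m) ℤ.- s m
        ≡⟨ cong₂ ℤ._-_ (𝟙-yes (S? (p + m)) (+p-closed m∈S)) (𝟙-yes (S? m) m∈S) ⟩
      + 0
        ≡⟨ 𝟙-no (Apéry? (p + m)) (λ ap → Apéry-minimal coprime ap m∈S) ⟨
      w (p + m)
        ∎
      where open ≡-Reasoning
    ... | no  m∉S = begin
      s (p + m) ℤ.- s m  ≡⟨ cong (ℤ._-_ (s (p + m))) (𝟙-no (S? m) m∉S) ⟩
      s (p + m) ℤ.- + 0  ≡⟨ ℤ.+-identityʳ (s (p + m)) ⟩
      s (p + m)          ≡⟨ 𝟙-cong (S? (p + m)) (Apéry? (p + m))
                                   (mk⇔ (λ h → S⇒Apéry h no-predecessor) Apéry⇒S) ⟩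
      w (p + m)          ∎
      where
      open ≡-Reasoning
      no-predecessor : ∀ m′ → p + m ≡ p + m′ → ¬ S m′
      no-predecessor m′ eq = subst (λ x → ¬ S x) (+-cancelˡ-≡ p m m′ eq) m∉S

  Δq[w]≗Δpq[δ₀] : Δ q w ≗ Δ (p * q) (δ 0)
  Δq[w]≗Δpq[δ₀] n =
    trans (Δ-≗-intro q below above n) (cong (ℤ._-_ (δ 0 n)) (sym (shift-δ₀ (p * q) n)))
    where
    q+m≢0 : ∀ {m} → q + m ≢ 0
    q+m≢0 eq = ≢-nonZero⁻¹ q (m+n≡0⇒m≡0 q eq)
    below : ∀ n → n < q → w n ≡ δ 0 n ℤ.- δ (p * q) n
    below n n<q = begin
      w n                    ≡⟨ 𝟙-cong (Apéry? n) (n ≟ 0) (mk⇔ Apéry⇒≡0 ≡0⇒Apéry) ⟩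
      δ 0 n                  ≡⟨ ℤ.+-identityʳ (δ 0 n) ⟨
      δ 0 n ℤ.- + 0          ≡⟨ cong (ℤ._-_ (δ 0 n)) (𝟙-no (n ≟ p * q) n≢pq) ⟨
      δ 0 n ℤ.- δ (p * q) n  ∎
      where
      open ≡-Reasoning
      Apéry⇒≡0 : Apéry n → n ≡ 0
      Apéry⇒≡0 (zero  , _ , eq) = sym eq
      Apéry⇒≡0 (suc j , _ , eq) = contradiction (subst (q ≤_) eq (m≤m+n q (j * q))) (<⇒≱ n<q)
      ≡0⇒Apéry : n ≡ 0 → Apéry n
      ≡0⇒Apéry n≡0 = 0 , >-nonZero⁻¹ p , sym n≡0
      n≢pq : n ≢ p * q
      n≢pq n≡pq = <⇒≱ n<q (subst (q ≤_) (sym n≡pq) (m≤n*m q p))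
    above : ∀ m → w (q + m) ℤ.- w m ≡ δ 0 (q + m) ℤ.- δ (p * q) (q + m)
    above m = by-cases (Apéry? m) (q + m ≟ p * q)
      where
      by-cases : Dec (Apéry m) → Dec (q + m ≡ p * q) →
                 w (q + m) ℤ.- w m ≡ δ 0 (q + m) ℤ.- δ (p * q) (q + m)
      by-cases (yes ap) (yes q+m≡pq) =
        trans (cong₂ ℤ._-_ (𝟙-no (Apéry? (q + m)) λ ap′ → proj₂ (Apéry-step⁻ ap′) q+m≡pq)
                           (𝟙-yes (Apéry? m) ap))
              (sym (cong₂ ℤ._-_ (𝟙-no (q + m ≟ 0) q+m≢0) (𝟙-yes (q + m ≟ p * q) q+m≡pq)))
      by-cases (yes ap) (no q+m≢pq) =
        trans (cong₂ ℤ._-_ (𝟙-yes (Apéry? (q + m)) (Apéry-step⁺ ap q+m≢pq)) (𝟙-yes (Apéry? m) ap))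
              (sym (cong₂ ℤ._-_ (𝟙-no (q + m ≟ 0) q+m≢0) (𝟙-no (q + m ≟ p * q) q+m≢pq)))
      by-cases (no ¬ap) _ =
        trans (cong₂ ℤ._-_ (𝟙-no (Apéry? (q + m)) λ ap′ → ¬ap (proj₁ (Apéry-step⁻ ap′)))
                           (𝟙-no (Apéry? m) ¬ap))
              (sym (cong₂ ℤ._-_ (𝟙-no (q + m ≟ 0) q+m≢0)
                                (𝟙-no (q + m ≟ p * q) λ eq → ¬ap (q+m≡pq⇒Apéry eq))))

  IsQ⇒coeff≗Δs : Coprime p q → ∀ Q → IsQ p q Q → coeff Q ≗ Δ 1 s
  IsQ⇒coeff≗Δs coprime Q isQ = Δ-injective (>-nonZero⁻¹ p) (Δ-injective (>-nonZero⁻¹ q) λ n → begin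
    Δ q (Δ p (coeff Q)) n    ≡⟨ IsQ⇒Δ-coeff p q Q isQ n ⟩
    Δ 1 (Δ (p * q) (δ 0)) n  ≡⟨ Δ-cong 1 Δq[w]≗Δpq[δ₀] n ⟨
    Δ 1 (Δ q w) n            ≡⟨ Δ-cong 1 (Δ-cong q (Δp[s]≗w coprime)) n ⟨
    Δ 1 (Δ q (Δ p s)) n      ≡⟨ Δ-comm 1 q (Δ p s) n ⟩
    Δ q (Δ 1 (Δ p s)) n      ≡⟨ Δ-cong q (Δ-comm 1 p s) n ⟩
    Δ q (Δ p (Δ 1 s)) n      ∎)
    where open ≡-Reasoning

  members-run-short : ∀ {m g} → (∀ t → t < g → S (m + t)) → ¬ S (m + g) → g < p
  members-run-short {m} {g} run m+g∉S =
    ≰⇒> λ p≤g → m+g∉S (subst S (back p≤g) (+p-closed (run (g ∸ p) (g∸p<g p≤g))))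
    where
    g∸p<g : p ≤ g → g ∸ p < g
    g∸p<g = ∸-monoʳ-< (>-nonZero⁻¹ p)
    back : p ≤ g → p + (m + (g ∸ p)) ≡ m + g
    back p≤g =
      trans (+-comm p (m + (g ∸ p))) (trans (+-assoc m (g ∸ p) p) (cong (_+_ m) (m∸n+n≡m p≤g)))

  non-members-run-short : ∀ {n g} → S n → (∀ t → t < g → ¬ S (suc n + t)) → g < p
  non-members-run-short {n} {g} n∈S run =
    ≰⇒> λ p≤g → run (pred p) (<-≤-trans pred[p]<p p≤g) (subst S forth (+p-closed n∈S))
    where
    pred[p]<p : pred p < p
    pred[p]<p = subst (pred p <_) (suc-pred p) (n<1+n (pred p))
    forth : p + n ≡ suc n + pred p
    forth = trans (+-comm p n) (trans (cong (_+_ n) (sym (suc-pred p))) (+-suc n (pred p)))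

data Adjacent (x y : ℕ) : List ℕ → Set where
  here  : ∀ {zs} → Adjacent x y (x ∷ y ∷ zs)
  there : ∀ {z zs} → Adjacent x y zs → Adjacent x y (z ∷ zs)

Adjacent-∷⁻ : ∀ {x y z zs} → Adjacent x y (z ∷ zs) →
              (x ≡ z × ∃ λ r → zs ≡ y ∷ r) ⊎ Adjacent x y zs
Adjacent-∷⁻ here        = inj₁ (refl , _ , refl)
Adjacent-∷⁻ (there adj) = inj₂ adj

∈-gaps⁺ : ∀ {x y zs} → Adjacent x y zs → y ∸ x ∈ gaps zs
∈-gaps⁺ here                     = here refl
∈-gaps⁺ (there {zs = _ ∷ _} adj) = there (∈-gaps⁺ adj)

∈-gaps⁻ : ∀ {d} zs → d ∈ gaps zs → ∃₂ λ x y → Adjacent x y zs × d ≡ y ∸ x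
∈-gaps⁻ (x ∷ y ∷ zs) (here d≡y∸x) = x , y , here , d≡y∸x
∈-gaps⁻ (x ∷ y ∷ zs) (there d∈)   with ∈-gaps⁻ (y ∷ zs) d∈
... | x′ , y′ , adj , d≡y′∸x′ = x′ , y′ , there adj , d≡y′∸x′

record ConsecutiveExponents (f : Poly) (m m′ : ℕ) : Set where
  field
    m<m′     : m < m′
    nonzero  : coeff f m ≢ + 0
    nonzero′ : coeff f m′ ≢ + 0
    between  : ∀ l → m < l → l < m′ → coeff f l ≡ + 0

module Exponents where

  open import Data.Nat using (_+_)
  open import Data.Nat.Properties using (+-identityʳ; +-suc; ≤-pred)
  open import Relation.Nullary using (contradiction)
  open ConsecutiveExponents

  LeadingZeros : Poly → ℕ → Set
  LeadingZeros f m = ∀ l → l < m → coeff f l ≡ + 0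

  expsFrom-first⁺ : ∀ i f {m} → LeadingZeros f m → coeff f m ≢ + 0 →
                    ∃ λ r → expsFrom i f ≡ (i + m) ∷ r
  expsFrom-first⁺ i []      zeros nz = contradiction refl nz
  expsFrom-first⁺ i (a ∷ f) {zero} zeros nz with a ℤ.≟ + 0
  ... | yes a≡0 = contradiction a≡0 nz
  ... | no  _   = expsFrom (suc i) f , cong (_∷ expsFrom (suc i) f) (sym (+-identityʳ i))
  expsFrom-first⁺ i (a ∷ f) {suc m} zeros nz with a ℤ.≟ + 0
  ... | no  a≢0 = contradiction (zeros 0 z<s) a≢0
  ... | yes _   with expsFrom-first⁺ (suc i) f (λ l l<m → zeros (suc l) (s≤s l<m)) nz
  ...   | r , eq = r , trans eq (cong (_∷ r) (sym (+-suc i m)))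

  expsFrom-first⁻ : ∀ i f {e r} → expsFrom i f ≡ e ∷ r →
                    ∃ λ m → e ≡ i + m × coeff f m ≢ + 0 × LeadingZeros f m
  expsFrom-first⁻ i (a ∷ f) eq with a ℤ.≟ + 0
  expsFrom-first⁻ i (a ∷ f) refl | no a≢0 = 0 , sym (+-identityʳ i) , a≢0 , λ _ ()
  ... | yes a≡0 with expsFrom-first⁻ (suc i) f eq
  ...   | m , e≡ , nz , zeros = suc m , trans e≡ (sym (+-suc i m)) , nz , zeros′
    where
    zeros′ : LeadingZeros (a ∷ f) (suc m)
    zeros′ zero    _         = a≡0
    zeros′ (suc l) (s≤s l<m) = zeros l l<m

  consecutive-∷⁻ : ∀ {a f m m′} → ConsecutiveExponents (a ∷ f) (suc m) (suc m′) →
                   ConsecutiveExponents f m m′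
  consecutive-∷⁻ c = record
    { m<m′ = ≤-pred (m<m′ c) ; nonzero = nonzero c ; nonzero′ = nonzero′ c
    ; between = λ l m<l l<m′ → between c (suc l) (s≤s m<l) (s≤s l<m′) }

  consecutive-∷⁺ : ∀ {a f m m′} → ConsecutiveExponents f m m′ →
                   ConsecutiveExponents (a ∷ f) (suc m) (suc m′)
  consecutive-∷⁺ c = record
    { m<m′ = s≤s (m<m′ c) ; nonzero = nonzero c ; nonzero′ = nonzero′ c ; between = between′ }
    where
    between′ : ∀ l → suc _ < l → l < suc _ → coeff (_ ∷ _) l ≡ + 0
    between′ (suc l) (s≤s m<l) (s≤s l<m′) = between c l m<l l<m′

  expsFrom-Adjacent⁺ : ∀ i f {m m′} → ConsecutiveExponents f m m′ →
                       Adjacent (i + m) (i + m′) (expsFrom i f)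
  expsFrom-Adjacent⁺ i []      c = contradiction refl (nonzero c)
  expsFrom-Adjacent⁺ i (a ∷ f) {zero} {suc m′} c with a ℤ.≟ + 0
  ... | yes a≡0 = contradiction a≡0 (nonzero c)
  ... | no  _   with expsFrom-first⁺ (suc i) f (λ l l<m′ → between c (suc l) z<s (s≤s l<m′))
                                     (nonzero′ c)
  ...   | r , eq rewrite eq | +-identityʳ i | +-suc i m′ = here
  expsFrom-Adjacent⁺ i (a ∷ f) {suc m} {suc m′} c with expsFrom-Adjacent⁺ (suc i) f (consecutive-∷⁻ c)
  ... | adj rewrite +-suc i m | +-suc i m′ with a ℤ.≟ + 0
  ...   | yes _ = adj
  ...   | no  _ = there adj

  ExponentPairFrom : ℕ → Poly → ℕ → ℕ → Set
  ExponentPairFrom i f x y = ∃₂ λ m m′ → x ≡ i + m × y ≡ i + m′ × ConsecutiveExponents f m m′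

  ExponentPairFrom-∷ : ∀ {i a f x y} → ExponentPairFrom (suc i) f x y → ExponentPairFrom i (a ∷ f) x y
  ExponentPairFrom-∷ {i} (m , m′ , x≡ , y≡ , c) =
    suc m , suc m′ , trans x≡ (sym (+-suc i m)) , trans y≡ (sym (+-suc i m′)) , consecutive-∷⁺ c

  expsFrom-Adjacent⁻ : ∀ i f {x y} → Adjacent x y (expsFrom i f) → ExponentPairFrom i f x y
  expsFrom-Adjacent⁻ i (a ∷ f) adj with a ℤ.≟ + 0
  ... | yes _ = ExponentPairFrom-∷ (expsFrom-Adjacent⁻ (suc i) f adj)
  ... | no a≢0 with Adjacent-∷⁻ adj
  ...   | inj₂ adj′ = ExponentPairFrom-∷ (expsFrom-Adjacent⁻ (suc i) f adj′)
  ...   | inj₁ (x≡i , r , eq) with expsFrom-first⁻ (suc i) f eq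
  ...     | m′ , y≡ , nz , zeros =
    0 , suc m′ , trans x≡i (sym (+-identityʳ i)) , trans y≡ (sym (+-suc i m′)) ,
    record { m<m′ = z<s ; nonzero = a≢0 ; nonzero′ = nz ; between = between′ }
    where
    between′ : ∀ l → 0 < l → l < suc m′ → coeff (a ∷ f) l ≡ + 0
    between′ (suc l) _ (s≤s l<m′) = zeros l l<m′

  ∈-gaps-exps⁺ : ∀ f {m m′} → ConsecutiveExponents f m m′ → m′ ∸ m ∈ gaps (exps f)
  ∈-gaps-exps⁺ f c = ∈-gaps⁺ (expsFrom-Adjacent⁺ 0 f c)

  ∈-gaps-exps⁻ : ∀ f {d} → d ∈ gaps (exps f) →
                 ∃₂ λ m m′ → ConsecutiveExponents f m m′ × d ≡ m′ ∸ m
  ∈-gaps-exps⁻ f d∈ with ∈-gaps⁻ (exps f) d∈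
  ... | x , y , adj , d≡y∸x with expsFrom-Adjacent⁻ 0 f adj
  ...   | m , m′ , refl , refl , c = m , m′ , c , d≡y∸x

open Exponents using (∈-gaps-exps⁺; ∈-gaps-exps⁻)

module _ {A : Set} where

  open import Data.Nat.Properties using (+-suc)
  open import Data.List using (length; _++_)
  open import Data.List.Properties using (length-++)
  open import Data.List.Relation.Unary.All as All using ()
  open import Data.List.Relation.Unary.AllPairs using (_∷_)
  open import Data.List.Relation.Unary.Unique.Propositional using (Unique)
  open import Data.List.Membership.Propositional.Properties using (∈-∃++; ∈-++⁻; ∈-++⁺ˡ; ∈-++⁺ʳ)
  open import Data.List.Relation.Binary.Subset.Propositional using (_⊆_)
  open import Relation.Nullary using (contradiction)

  Unique-⊆⇒length≤ : ∀ {xs ys : List A} → Unique xs → xs ⊆ ys → length xs ≤ length ys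
  Unique-⊆⇒length≤ {[]}     _          _       = z≤n
  Unique-⊆⇒length≤ {x ∷ xs} (x∉xs ∷ u) x∷xs⊆ys with ∈-∃++ (x∷xs⊆ys (here refl))
  ... | as , bs , refl =
    subst (suc (length xs) ≤_) (sym length-as++x∷bs) (s≤s (Unique-⊆⇒length≤ u xs⊆as++bs))
    where
    length-as++x∷bs : length (as ++ x ∷ bs) ≡ suc (length (as ++ bs))
    length-as++x∷bs =
      trans (length-++ as) (trans (+-suc (length as) (length bs)) (cong suc (sym (length-++ as))))
    xs⊆as++bs : xs ⊆ as ++ bs
    xs⊆as++bs {y} y∈xs with ∈-++⁻ as (x∷xs⊆ys (there y∈xs))
    ... | inj₁ y∈as         = ∈-++⁺ˡ y∈as
    ... | inj₂ (here y≡x)   = contradiction (sym y≡x) (All.lookup x∉xs y∈xs)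
    ... | inj₂ (there y∈bs) = ∈-++⁺ʳ as y∈bs

<⇒≤∸1 : ∀ {m n} → m < n → m ≤ n ∸ 1
<⇒≤∸1 {n = suc n} (s≤s m≤n) = m≤n

module GapsOfQ (p q : ℕ) .{{_ : ℕ.NonZero p}} .{{_ : ℕ.NonZero q}} (coprime : Coprime p q)
               (Q : Poly) (isQ : IsQ p q Q) where

  open import Data.Nat using (_+_; _≤′_; ≤′-refl; ≤′-step)
  open import Data.Nat.Properties
  open import Data.List using (applyUpTo)
  open import Data.List.Properties using (length-applyUpTo)
  open import Data.List.Membership.Propositional.Properties using (∈-deduplicate⁻; ∈-applyUpTo⁺)
  open import Data.List.Relation.Unary.Unique.DecPropositional.Properties ℕ._≟_ using (deduplicate-!)
  open import Data.List.Relation.Binary.Subset.Propositional using (_⊆_)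
  open import Relation.Nullary using (contradiction)
  open import Relation.Nullary.Decidable using (toSum)
  open import Function.Construct.Identity using (⇔-id)
  open import Function.Construct.Composition using (_⇔-∘_)
  open NumericalSemigroup p q
  open ConsecutiveExponents
  open Equivalence

  coeff-Q≗Δs : coeff Q ≗ Δ 1 s
  coeff-Q≗Δs = IsQ⇒coeff≗Δs coprime Q isQ

  same-membership : ∀ {l} → coeff Q (suc l) ≡ + 0 → S (suc l) ⇔ S l
  same-membership {l} ≡0 = 𝟙-sub-≡0 (S? (suc l)) (S? l) (trans (sym (coeff-Q≗Δs (suc l))) ≡0)

  flipped-membership : ∀ {l} → coeff Q (suc l) ≢ + 0 → (S (suc l) → ¬ S l) × (¬ S (suc l) → S l)
  flipped-membership {l} ≢0 =
    𝟙-sub-≢0 (S? (suc l)) (S? l) λ ≡0 → ≢0 (trans (coeff-Q≗Δs (suc l)) ≡0)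

  drop⇒nonzero : ∀ {l} → S l → ¬ S (suc l) → coeff Q (suc l) ≢ + 0
  drop⇒nonzero l∈S 1+l∉S ≡0 = 1+l∉S (from (same-membership ≡0) l∈S)

  rise⇒nonzero : ∀ {l} → ¬ S l → S (suc l) → coeff Q (suc l) ≢ + 0
  rise⇒nonzero l∉S 1+l∈S ≡0 = l∉S (to (same-membership ≡0) 1+l∈S)

  outside⇒zero : ∀ {l} → ¬ S l → ¬ S (suc l) → coeff Q (suc l) ≡ + 0
  outside⇒zero {l} l∉S 1+l∉S =
    trans (coeff-Q≗Δs (suc l)) (cong₂ ℤ._-_ (𝟙-no (S? (suc l)) 1+l∉S) (𝟙-no (S? l) l∉S))

  constant-between : ∀ {m m′} → ConsecutiveExponents Q m m′ →
                     ∀ {l} → m ≤′ l → l < m′ → S l ⇔ S m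
  constant-between c ≤′-refl              _      = ⇔-id _
  constant-between c (≤′-step {l} m≤′l) 1+l<m′ =
    constant-between c m≤′l (<-trans (n<1+n l) 1+l<m′)
      ⇔-∘ same-membership (between c (suc l) (s≤s (≤′⇒≤ m≤′l)) 1+l<m′)

  constant-on-offsets : ∀ {m m′} → ConsecutiveExponents Q m m′ →
                        ∀ t → t < m′ ∸ m → S (m + t) ⇔ S m
  constant-on-offsets {m} {m′} c t t<m′∸m = constant-between c (≤⇒≤′ (m≤m+n m t))
    (subst (m + t <_) (m+[n∸m]≡n (<⇒≤ (m<m′ c))) (+-monoʳ-< m t<m′∸m))

  gap<p-member : ∀ {m m′} → ConsecutiveExponents Q m m′ → S m → m′ ∸ m < p
  gap<p-member {m} {zero}  c _   = contradiction (m<m′ c) λ ()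
  gap<p-member {m} {suc l} c m∈S =
    members-run-short (λ t t<g → from (constant-on-offsets c t t<g) m∈S)
                      (subst (λ x → ¬ S x) (sym (m+[n∸m]≡n (<⇒≤ (m<m′ c)))) 1+l∉S)
    where
    1+l∉S : ¬ S (suc l)
    1+l∉S h = proj₁ (flipped-membership (nonzero′ c)) h
                    (from (constant-between c (≤⇒≤′ (≤-pred (m<m′ c))) (n<1+n l)) m∈S)

  gap<p-non-member : ∀ {m m′} → ConsecutiveExponents Q m m′ → ¬ S m → m′ ∸ m < p
  gap<p-non-member {zero}  c 0∉S = contradiction 0∈S 0∉S
  gap<p-non-member {suc n} c m∉S =
    non-members-run-short (proj₂ (flipped-membership (nonzero c)) m∉S)
                          λ t t<g h → m∉S (to (constant-on-offsets c t t<g) h)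

  gap<p : ∀ {m m′} → ConsecutiveExponents Q m m′ → m′ ∸ m < p
  gap<p {m} c = [ gap<p-member c , gap<p-non-member c ]′ (toSum (S? m))

  gap-bounds : ∀ {d} → d ∈ gaps (exps Q) → 0 < d × d < p
  gap-bounds d∈ with ∈-gaps-exps⁻ Q d∈
  ... | m , m′ , c , refl = m<n⇒0<n∸m (m<m′ c) , gap<p c

  #G≤p∸1 : #G Q ≤ p ∸ 1
  #G≤p∸1 = subst (#G Q ≤_) (length-applyUpTo suc (p ∸ 1))
                 (Unique-⊆⇒length≤ (deduplicate-! (gaps (exps Q))) gapset⊆1…p∸1)
    where
    gapset⊆1…p∸1 : gapset Q ⊆ applyUpTo suc (p ∸ 1)
    gapset⊆1…p∸1 d∈ with gap-bounds (∈-deduplicate⁻ ℕ._≟_ (gaps (exps Q)) d∈)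
    ... | s≤s _ , d<p = ∈-applyUpTo⁺ suc (<⇒≤∸1 d<p)

  gap-between-members : ∀ {m m′} → S m → S m′ → (∀ n → m < n → n < m′ → ¬ S n) →
                        suc m < m′ → m′ ∸ suc m ∈ gaps (exps Q)
  gap-between-members {m} {suc l} m∈S m′∈S free 1+m<m′ = ∈-gaps-exps⁺ Q record
    { m<m′     = 1+m<m′
    ; nonzero  = drop⇒nonzero m∈S (free (suc m) ≤-refl 1+m<m′)
    ; nonzero′ = rise⇒nonzero (free l (≤-pred 1+m<m′) ≤-refl) m′∈S
    ; between  = zeros }
    where
    zeros : ∀ n → suc m < n → n < suc l → coeff Q n ≡ + 0
    zeros (suc n) 1+m<1+n 1+n<1+l =
      outside⇒zero (free n (≤-pred 1+m<1+n) (<-trans (n<1+n n) 1+n<1+l))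
                   (free (suc n) (<-trans (n<1+n m) 1+m<1+n) 1+n<1+l)

  interval-gap : ∀ {m d} → S m → S (m + d) → (∀ n → m < n → n < m + d → ¬ S n) → 2 ≤ d →
                 d ∸ 1 ∈ gaps (exps Q)
  interval-gap {m} {d} m∈S m+d∈S free 2≤d =
    subst (_∈ gaps (exps Q)) m+d∸[1+m]≡d∸1 (gap-between-members m∈S m+d∈S free 1+m<m+d)
    where
    1+m<m+d : suc m < m + d
    1+m<m+d = subst (_≤ m + d) (+-comm m 2) (+-monoʳ-≤ m 2≤d)
    m+d∸[1+m]≡d∸1 : m + d ∸ suc m ≡ d ∸ 1
    m+d∸[1+m]≡d∸1 = trans (cong (m + d ∸_) (+-comm 1 m)) ([m+n]∸[m+o]≡n∸o m d 1)

-- Farey neighbours l/k < q/p < k′/l′, with a = kq − lp and b = k′p − l′q.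

record Bracket (p q a b : ℕ) : Set where
  field
    k l k′ l′  : ℕ
    lower      : k ℕ.* q ≡ l ℕ.* p ℕ.+ a
    upper      : k′ ℕ.* p ≡ l′ ℕ.* q ℕ.+ b
    unimodular : k ℕ.* k′ ≡ suc (l ℕ.* l′)
    l>0        : 0 < l
    l′>0       : 0 < l′
    a>0        : 0 < a
    b>0        : 0 < b

module Brackets where

  open import Data.Nat using (_+_; _*_; _<?_; >-nonZero; NonZero; _%_; _/_)
  open import Data.Nat.Properties
  open import Data.Nat.DivMod using (m≡m%n+[m/n]*n; m%n<n; m≥n⇒m/n>0)
  open import Data.Nat.Divisibility using (divides; ∣-refl; m%n≡0⇒n∣m)
  import Data.Nat.Tactic.RingSolver as ℕ-Solver

  module _ {p q a b : ℕ} (br : Bracket p q a b) where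

    open Bracket br

    swap : Bracket q p b a
    swap = record
      { k = k′ ; l = l′ ; k′ = k ; l′ = l
      ; lower = upper ; upper = lower
      ; unimodular = trans (*-comm k′ k) (trans unimodular (cong suc (*-comm l l′)))
      ; l>0 = l′>0 ; l′>0 = l>0 ; a>0 = b>0 ; b>0 = a>0 }

    p≡ : p ≡ a * l′ + b * k
    p≡ = sym (+-cancelʳ-≡ (l * l′ * p + k * l′ * q) _ _ (begin
      (a * l′ + b * k) + (l * l′ * p + k * l′ * q)
        ≡⟨ expand a b k l l′ p q ⟩
      (l * p + a) * l′ + (l′ * q + b) * k
        ≡⟨ cong₂ (λ x y → x * l′ + y * k) lower upper ⟨
      k * q * l′ + k′ * p * k
        ≡⟨ regroup k k′ l′ p q ⟩
      k * k′ * p + k * l′ * q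
        ≡⟨ cong (λ x → x * p + k * l′ * q) unimodular ⟩
      suc (l * l′) * p + k * l′ * q
        ≡⟨ +-assoc p (l * l′ * p) (k * l′ * q) ⟩
      p + (l * l′ * p + k * l′ * q)
        ∎))
      where
      open ≡-Reasoning
      expand : ∀ a b k l l′ p q →
               (a * l′ + b * k) + (l * l′ * p + k * l′ * q) ≡ (l * p + a) * l′ + (l′ * q + b) * k
      expand = ℕ-Solver.solve-∀
      regroup : ∀ k k′ l′ p q → k * q * l′ + k′ * p * k ≡ k * k′ * p + k * l′ * q
      regroup = ℕ-Solver.solve-∀

    k′>0 : 0 < k′
    k′>0 = n≢0⇒n>0 λ k′≡0 →
      0≢1+n (trans (sym (*-zeroʳ k)) (trans (cong (k *_) (sym k′≡0)) unimodular))

    stepˡ : b < a → Bracket p q (a ∸ b) b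
    stepˡ b<a = record
      { k = k + l′ ; l = l + k′ ; k′ = k′ ; l′ = l′
      ; lower = lower′ ; upper = upper ; unimodular = unimodular′
      ; l>0 = ≤-trans l>0 (m≤m+n l k′) ; l′>0 = l′>0 ; a>0 = m<n⇒0<n∸m b<a ; b>0 = b>0 }
      where
      open ≡-Reasoning
      b≤a = <⇒≤ b<a
      lower′ : (k + l′) * q ≡ (l + k′) * p + (a ∸ b)
      lower′ = begin
        (k + l′) * q                    ≡⟨ *-distribʳ-+ q k l′ ⟩
        k * q + l′ * q                  ≡⟨ cong (_+ l′ * q) lower ⟩
        l * p + a + l′ * q              ≡⟨ cong (λ x → l * p + x + l′ * q) (m∸n+n≡m b≤a) ⟨
        l * p + (a ∸ b + b) + l′ * q    ≡⟨ regroup (l * p) (a ∸ b) b (l′ * q) ⟩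
        l * p + (l′ * q + b) + (a ∸ b)  ≡⟨ cong (λ x → l * p + x + (a ∸ b)) upper ⟨
        l * p + k′ * p + (a ∸ b)        ≡⟨ cong (_+ (a ∸ b)) (*-distribʳ-+ p l k′) ⟨
        (l + k′) * p + (a ∸ b)          ∎
        where
        regroup : ∀ x y z w → x + (y + z) + w ≡ x + (w + z) + y
        regroup = ℕ-Solver.solve-∀
      unimodular′ : (k + l′) * k′ ≡ suc ((l + k′) * l′)
      unimodular′ = begin
        (k + l′) * k′           ≡⟨ *-distribʳ-+ k′ k l′ ⟩
        k * k′ + l′ * k′        ≡⟨ cong (_+ l′ * k′) unimodular ⟩
        suc (l * l′) + l′ * k′  ≡⟨ cong suc (regroup l l′ k′) ⟩
        suc ((l + k′) * l′)     ∎
        where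
        regroup : ∀ l l′ k′ → l * l′ + l′ * k′ ≡ (l + k′) * l′
        regroup = ℕ-Solver.solve-∀

  q≡ : ∀ {p q a b} (br : Bracket p q a b) → q ≡ b * Bracket.l br + a * Bracket.k′ br
  q≡ br = p≡ (swap br)

  stepʳ : ∀ {p q a b} → Bracket p q a b → a < b → Bracket p q a (b ∸ a)
  stepʳ br a<b = swap (stepˡ (swap br) a<b)

  module _ {p q a b : ℕ} (br : Bracket p q a b) where

    open Bracket br

    -- With n = aσ + bτ, comparing (σ, τ) with l·(l′, k) gives n ≤ lp or kq ≤ n;
    -- the two mixed cases contradict kσ = l′τ + j and k′τ = lσ + i.

    lattice-gap : ∀ {n} → l * p < n → n < k * q → ¬ n ∈⟨ p , q ⟩
    lattice-gap {n} lp<n n<kq (i , j , ip+jq≡n) = by-cases (σ ≤? l * l′) (τ ≤? l * k) (τ <? l * k)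
      where
      σ τ : ℕ
      σ = i * l′ + j * k′
      τ = i * k + j * l

      n≡ : n ≡ a * σ + b * τ
      n≡ = begin
        n                                            ≡⟨ ip+jq≡n ⟨
        i * p + j * q                                ≡⟨ cong₂ (λ x y → i * x + j * y) (p≡ br) (q≡ br) ⟩
        i * (a * l′ + b * k) + j * (b * l + a * k′)  ≡⟨ expand a b i j k l k′ l′ ⟩
        a * σ + b * τ                                ∎
        where
        open ≡-Reasoning
        expand : ∀ a b i j k l k′ l′ → i * (a * l′ + b * k) + j * (b * l + a * k′) ≡
                                       a * (i * l′ + j * k′) + b * (i * k + j * l)
        expand = ℕ-Solver.solve-∀

      lp≡ : l * p ≡ a * (l * l′) + b * (l * k)
      lp≡ = trans (cong (l *_) (p≡ br)) (expand a b k l l′)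
        where
        expand : ∀ a b k l l′ → l * (a * l′ + b * k) ≡ a * (l * l′) + b * (l * k)
        expand = ℕ-Solver.solve-∀

      kq≡ : k * q ≡ a * suc (l * l′) + b * (l * k)
      kq≡ = trans lower (trans (cong (_+ a) lp≡) (regroup a b (l * l′) (l * k)))
        where
        regroup : ∀ a b x y → a * x + b * y + a ≡ a * suc x + b * y
        regroup = ℕ-Solver.solve-∀

      kσ≡l′τ+j : k * σ ≡ l′ * τ + j
      kσ≡l′τ+j = begin
        k * σ                          ≡⟨ regroup i j k k′ l′ ⟩
        i * k * l′ + j * (k * k′)      ≡⟨ cong (λ x → i * k * l′ + j * x) unimodular ⟩
        i * k * l′ + j * suc (l * l′)  ≡⟨ expand i j k l l′ ⟩
        l′ * τ + j                     ∎
        where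
        open ≡-Reasoning
        regroup : ∀ i j k k′ l′ → k * (i * l′ + j * k′) ≡ i * k * l′ + j * (k * k′)
        regroup = ℕ-Solver.solve-∀
        expand : ∀ i j k l l′ → i * k * l′ + j * suc (l * l′) ≡ l′ * (i * k + j * l) + j
        expand = ℕ-Solver.solve-∀

      k′τ≡lσ+i : k′ * τ ≡ l * σ + i
      k′τ≡lσ+i = begin
        k′ * τ                         ≡⟨ regroup i j k k′ l ⟩
        i * (k * k′) + j * l * k′      ≡⟨ cong (λ x → i * x + j * l * k′) unimodular ⟩
        i * suc (l * l′) + j * l * k′  ≡⟨ expand i j k′ l l′ ⟩
        l * σ + i                      ∎
        where
        open ≡-Reasoning
        regroup : ∀ i j k k′ l → k′ * (i * k + j * l) ≡ i * (k * k′) + j * l * k′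
        regroup = ℕ-Solver.solve-∀
        expand : ∀ i j k′ l l′ → i * suc (l * l′) + j * l * k′ ≡ l * (i * l′ + j * k′) + i
        expand = ℕ-Solver.solve-∀

      x*y<x*suc[y] : ∀ {x} y → 0 < x → x * y < x * suc y
      x*y<x*suc[y] {x} y x>0 = subst (x * y <_) (sym (*-suc x y)) (m<n+m (x * y) x>0)

      by-cases : Dec (σ ≤ l * l′) → Dec (τ ≤ l * k) → Dec (τ < l * k) → ⊥
      by-cases (yes σ≤) (yes τ≤) _ = <⇒≱ lp<n (begin
        n                           ≡⟨ n≡ ⟩
        a * σ + b * τ               ≤⟨ +-mono-≤ (*-monoʳ-≤ a σ≤) (*-monoʳ-≤ b τ≤) ⟩
        a * (l * l′) + b * (l * k)  ≡⟨ lp≡ ⟨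
        l * p                       ∎)
        where open ≤-Reasoning
      by-cases (yes σ≤) (no τ≰) _ = <-irrefl refl (begin-strict
        l′ * τ            ≤⟨ m≤m+n (l′ * τ) j ⟩
        l′ * τ + j        ≡⟨ kσ≡l′τ+j ⟨
        k * σ             ≤⟨ *-monoʳ-≤ k σ≤ ⟩
        k * (l * l′)      ≡⟨ regroup k l l′ ⟩
        l′ * (l * k)      <⟨ x*y<x*suc[y] (l * k) l′>0 ⟩
        l′ * suc (l * k)  ≤⟨ *-monoʳ-≤ l′ (≰⇒> τ≰) ⟩
        l′ * τ            ∎)
        where
        open ≤-Reasoning
        regroup : ∀ k l l′ → k * (l * l′) ≡ l′ * (l * k)
        regroup = ℕ-Solver.solve-∀
      by-cases (no σ≰) _ (yes τ<) = <-irrefl refl (begin-strict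
        l * suc (l * l′)  ≤⟨ *-monoʳ-≤ l (≰⇒> σ≰) ⟩
        l * σ             ≤⟨ m≤m+n (l * σ) i ⟩
        l * σ + i         ≡⟨ k′τ≡lσ+i ⟨
        k′ * τ            <⟨ *-monoʳ-< k′ {{>-nonZero (k′>0 br)}} τ< ⟩
        k′ * (l * k)      ≡⟨ regroup k k′ l ⟩
        l * (k * k′)      ≡⟨ cong (l *_) unimodular ⟩
        l * suc (l * l′)  ∎)
        where
        open ≤-Reasoning
        regroup : ∀ k k′ l → k′ * (l * k) ≡ l * (k * k′)
        regroup = ℕ-Solver.solve-∀
      by-cases (no σ≰) _ (no τ≮) = <⇒≱ n<kq (begin
        k * q                           ≡⟨ kq≡ ⟩
        a * suc (l * l′) + b * (l * k)
          ≤⟨ +-mono-≤ (*-monoʳ-≤ a (≰⇒> σ≰)) (*-monoʳ-≤ b (≮⇒≥ τ≮)) ⟩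
        a * σ + b * τ                   ≡⟨ n≡ ⟨
        n                               ∎)
        where open ≤-Reasoning

  lattice-gap′ : ∀ {p q a b} (br : Bracket p q a b) {n} →
                 Bracket.l′ br * q < n → n < Bracket.k′ br * p → ¬ n ∈⟨ p , q ⟩
  lattice-gap′ br l′q<n n<k′p n∈S = lattice-gap (swap br) l′q<n n<k′p (∈⟨⟩-comm n∈S)

  diagonal : ∀ {p q a} → Coprime p q → Bracket p q a a → a ≡ 1
  diagonal {a = a} coprime br =
    coprime (divides (l′ + k) (trans (p≡ br) (factor a l′ k)) ,
             divides (l + k′) (trans (q≡ br) (factor a l k′)))
    where
    open Bracket br
    factor : ∀ a x y → a * x + a * y ≡ (x + y) * a
    factor = ℕ-Solver.solve-∀

  initial : ∀ {p q} .{{_ : NonZero p}} → Coprime p q → 2 ≤ p → p ≤ q →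
            Bracket p q (q % p) (p ∸ q % p)
  initial {p} {q} coprime 2≤p p≤q = record
    { k = 1 ; l = q / p ; k′ = suc (q / p) ; l′ = 1
    ; lower = lower ; upper = upper ; unimodular = unimodular
    ; l>0 = m≥n⇒m/n>0 p≤q ; l′>0 = z<s ; a>0 = r>0 ; b>0 = m<n⇒0<n∸m (m%n<n q p) }
    where
    open ≡-Reasoning
    r = q % p
    u = q / p
    q≡r+u*p : q ≡ r + u * p
    q≡r+u*p = m≡m%n+[m/n]*n q p
    lower : 1 * q ≡ u * p + r
    lower = trans (*-identityˡ q) (trans q≡r+u*p (+-comm r (u * p)))
    upper : suc u * p ≡ 1 * q + (p ∸ r)
    upper = begin
      p + u * p            ≡⟨ cong (_+ u * p) (m+[n∸m]≡n (<⇒≤ (m%n<n q p))) ⟨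
      r + (p ∸ r) + u * p  ≡⟨ regroup r (p ∸ r) (u * p) ⟩
      r + u * p + (p ∸ r)  ≡⟨ cong (_+ (p ∸ r)) (trans (sym q≡r+u*p) (sym (*-identityˡ q))) ⟩
      1 * q + (p ∸ r)      ∎
      where
      regroup : ∀ x y z → x + y + z ≡ x + z + y
      regroup = ℕ-Solver.solve-∀
    unimodular : 1 * suc u ≡ suc (u * 1)
    unimodular = cong suc (trans (+-identityʳ u) (sym (*-identityʳ u)))
    r>0 : 0 < r
    r>0 = n≢0⇒n>0 λ r≡0 → <⇒≱ 2≤p (≤-reflexive (coprime (∣-refl , m%n≡0⇒n∣m q p r≡0)))

F-pos : ∀ n → 0 < F n
F-pos zero          = z<s
F-pos (suc zero)    = z<s
F-pos (suc (suc n)) = ℕ.≤-trans (F-pos (suc n)) (ℕ.m≤m+n (F (suc n)) (F n))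

F-remainder : ∀ {n x y} → F (suc (suc n)) < x ℕ.+ y → x ≤ F (suc n) → F n < y
F-remainder F<x+y x≤F = ℕ.≰⇒> λ y≤F → ℕ.<⇒≱ F<x+y (ℕ.+-mono-≤ x≤F y≤F)

module SubtractiveEuclid (P : ℕ → ℕ → Set) (Good : ℕ → Set)
  (P-sym  : ∀ {a b} → P a b → P b a)
  (P-pos  : ∀ {a b} → P a b → 0 < b)
  (P-diag : ∀ {a} → P a a → a ≡ 1)
  (P-step : ∀ {a b} → P a b → b < a → P (a ∸ b) b)
  (P-good : ∀ {a b} → P a b → b < a → Good (a ∸ 1)) where

  open import Data.Nat using (_+_; _<?_; <-cmp)
  open import Data.Nat.Properties
  open import Data.List using (length)
  open import Data.List.Relation.Unary.All as All using (All; []; _∷_)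
  open import Data.List.Relation.Unary.AllPairs using ([]; _∷_)
  open import Data.List.Relation.Unary.Unique.Propositional using (Unique)
  open import Relation.Binary.Definitions using (tri<; tri≈; tri>)
  open import Relation.Nullary using (contradiction)

  -- The descent has just replaced the pair (x, y) by (x ∸ y, y), producing the value x ∸ 1.

  record State (x y : ℕ) : Set where
    field
      y<x  : y < x
      good : Good (x ∸ 1)
      pair : P (x ∸ y) y

  open State

  state : ∀ {a b} → P a b → b < a → State a b
  state pab b<a = record { y<x = b<a ; good = P-good pab b<a ; pair = P-step pab b<a }

  Next : ℕ → ℕ → Set
  Next x y = x ≡ 2 ⊎ ∃₂ λ x₁ y₁ → State x₁ y₁ × x₁ + y₁ ≡ x × y ≤ x₁

  descend : ∀ {x y} → State x y → Next x y
  descend {x} {y} st with <-cmp (x ∸ y) y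
  ... | tri> _ _ y<x∸y = inj₂ (x ∸ y , y , state (pair st) y<x∸y ,
                               m∸n+n≡m (<⇒≤ (y<x st)) , <⇒≤ y<x∸y)
  ... | tri< x∸y<y _ _ = inj₂ (y , x ∸ y , state (P-sym (pair st)) x∸y<y ,
                               trans (+-comm y (x ∸ y)) (m∸n+n≡m (<⇒≤ (y<x st))) , ≤-refl)
  ... | tri≈ _ x∸y≡y _ = inj₁ (begin
        x            ≡⟨ m∸n+n≡m (<⇒≤ (y<x st)) ⟨
        (x ∸ y) + y  ≡⟨ cong₂ _+_ (trans x∸y≡y y≡1) y≡1 ⟩
        2            ∎)
    where
    open ≡-Reasoning
    y≡1 : y ≡ 1
    y≡1 = P-diag (subst (λ z → P z y) x∸y≡y (pair st))

  GoodChain : ℕ → ℕ → Set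
  GoodChain x n = ∃ λ ds → length ds ≡ n × All Good ds × Unique ds × All (_< x) ds

  x∸1<x : ∀ {x y} → State x y → x ∸ 1 < x
  x∸1<x {suc x} _ = ≤-refl

  extend : ∀ {x y x₁ n} → State x y → x₁ < x → GoodChain x₁ n → GoodChain x (suc n)
  extend {x} st x₁<x (ds , length≡ , goods , unique , bounded) =
    x ∸ 1 ∷ ds , cong suc length≡ , good st ∷ goods ,
    All.map (λ d<x₁ x∸1≡d → <-irrefl (sym x∸1≡d) (<-≤-trans d<x₁ (<⇒≤∸1 x₁<x))) bounded
      ∷ unique ,
    x∸1<x st ∷ All.map (λ d<x₁ → <-trans d<x₁ x₁<x) bounded

  smaller : ∀ {x₁ y₁ x} → State x₁ y₁ → x₁ + y₁ ≡ x → x₁ < x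
  smaller {x₁} st₁ x₁+y₁≡x = subst (x₁ <_) x₁+y₁≡x (m<m+n x₁ (P-pos (pair st₁)))

  Chain : ℕ → Set
  Chain n = ∀ {x y} → State x y → F n < x → GoodChain x n

  -- Either the next larger entry already exceeds F (n + 1), or the one after it exceeds F n.

  chain-step : ∀ {n} → Chain (suc n) → Chain n → Chain (suc (suc n))
  chain-step {n} chain₁ chain₀ {x} st F<x = first (descend st)
    where
    first : Next x _ → GoodChain x (suc (suc n))
    first (inj₁ x≡2) =
      contradiction (subst (F (suc (suc n)) <_) x≡2 F<x) (≤⇒≯ (+-mono-≤ (F-pos (suc n)) (F-pos n)))
    first (inj₂ (x₁ , y₁ , st₁ , x₁+y₁≡x , _)) with F (suc n) <? x₁
    ... | yes F<x₁ = extend st (smaller st₁ x₁+y₁≡x) (chain₁ st₁ F<x₁)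
    ... | no  F≮x₁ = second (descend st₁)
      where
      F<y₁ : F n < y₁
      F<y₁ = F-remainder {n} (subst (F (suc (suc n)) <_) (sym x₁+y₁≡x) F<x) (≮⇒≥ F≮x₁)
      second : Next x₁ y₁ → GoodChain x (suc (suc n))
      second (inj₁ x₁≡2) = contradiction (<-≤-trans F<y₁ y₁≤1) (≤⇒≯ (F-pos n))
        where
        y₁≤1 : y₁ ≤ 1
        y₁≤1 = <⇒≤∸1 (subst (y₁ <_) x₁≡2 (y<x st₁))
      second (inj₂ (x₂ , y₂ , st₂ , x₂+y₂≡x₁ , y₁≤x₂)) =
        extend st (smaller st₁ x₁+y₁≡x)
          (extend st₁ (smaller st₂ x₂+y₂≡x₁) (chain₀ st₂ (<-≤-trans F<y₁ y₁≤x₂)))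

  chain : ∀ n → Chain n
  chain zero          st _ = [] , refl , [] , [] , []
  chain (suc zero)    st _ = _ ∷ [] , refl , good st ∷ [] , [] ∷ [] , x∸1<x st ∷ []
  chain (suc (suc n))      = chain-step (chain (suc n)) (chain n)

module LowerBound (p q : ℕ) .{{_ : ℕ.NonZero p}} .{{_ : ℕ.NonZero q}} (coprime : Coprime p q)
                  (Q : Poly) (isQ : IsQ p q Q) where

  open import Data.Nat using (_+_; _*_)
  open import Data.Nat.Properties
  open import Data.Nat.DivMod using (_%_; m%n<n)
  open import Data.List.Membership.Propositional.Properties using (∈-deduplicate⁺)
  open import Data.List.Relation.Unary.All as All using ()
  open NumericalSemigroup p q
  open GapsOfQ p q coprime Q isQ
  open Brackets

  bracket-gapˡ : ∀ {a b} → Bracket p q a b → 2 ≤ a → a ∸ 1 ∈ gaps (exps Q)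
  bracket-gapˡ br = interval-gap (l , 0 , +-identityʳ (l * p)) (subst S lower (0 , k , refl))
                      λ n lp<n n<lp+a → lattice-gap br lp<n (subst (n <_) (sym lower) n<lp+a)
    where open Bracket br

  bracket-gapʳ : ∀ {a b} → Bracket p q a b → 2 ≤ b → b ∸ 1 ∈ gaps (exps Q)
  bracket-gapʳ br = interval-gap (0 , l′ , refl) (subst S upper (k′ , 0 , +-identityʳ (k′ * p)))
                      λ n l′q<n n<l′q+b → lattice-gap′ br l′q<n (subst (n <_) (sym upper) n<l′q+b)
    where open Bracket br

  Bracketing : ℕ → ℕ → Set
  Bracketing a b = Bracket p q a b ⊎ Bracket p q b a

  Bracketing-sym : ∀ {a b} → Bracketing a b → Bracketing b a
  Bracketing-sym = [ inj₂ , inj₁ ]′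

  Bracketing-pos : ∀ {a b} → Bracketing a b → 0 < b
  Bracketing-pos = [ Bracket.b>0 , Bracket.a>0 ]′

  Bracketing-diag : ∀ {a} → Bracketing a a → a ≡ 1
  Bracketing-diag = [ diagonal coprime , diagonal coprime ]′

  Bracketing-step : ∀ {a b} → Bracketing a b → b < a → Bracketing (a ∸ b) b
  Bracketing-step (inj₁ br) b<a = inj₁ (stepˡ br b<a)
  Bracketing-step (inj₂ br) b<a = inj₂ (stepʳ br b<a)

  Bracketing-gap : ∀ {a b} → Bracketing a b → b < a → a ∸ 1 ∈ gaps (exps Q)
  Bracketing-gap (inj₁ br) b<a = bracket-gapˡ br (≤-trans (s≤s (Bracket.b>0 br)) b<a)
  Bracketing-gap (inj₂ br) b<a = bracket-gapʳ br (≤-trans (s≤s (Bracket.a>0 br)) b<a)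

  open SubtractiveEuclid Bracketing (_∈ gaps (exps Q))
         Bracketing-sym Bracketing-pos Bracketing-diag Bracketing-step Bracketing-gap

  module _ (2≤p : 2 ≤ p) (p≤q : p ≤ q) where

    no-member-below-p : ∀ n → 0 < n → n < p → ¬ S n
    no-member-below-p n 0<n n<p (zero  , zero  , refl) = <-irrefl refl 0<n
    no-member-below-p n 0<n n<p (zero  , suc j , refl) = <⇒≱ n<p (≤-trans p≤q (m≤m+n q (j * q)))
    no-member-below-p n 0<n n<p (suc i , j     , refl) =
      <⇒≱ n<p (≤-trans (m≤m+n p (i * p)) (m≤m+n _ (j * q)))

    start : State p (p ∸ q % p)
    start = record
      { y<x  = ∸-monoʳ-< (Bracket.a>0 br₀) r≤p
      ; good = interval-gap 0∈S (1 , 0 , trans (+-identityʳ (1 * p)) (*-identityˡ p)) no-member-below-p 2≤p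
      ; pair = inj₁ (subst (λ a → Bracket p q a (p ∸ q % p)) (sym (m∸[m∸n]≡n r≤p)) br₀) }
      where
      r≤p : q % p ≤ p
      r≤p = <⇒≤ (m%n<n q p)
      br₀ : Bracket p q (q % p) (p ∸ q % p)
      br₀ = initial coprime 2≤p p≤q

    k≤#G : ∀ k → F k < p → k ≤ #G Q
    k≤#G k Fk<p = GoodChain⇒≤#G (chain k start Fk<p)
      where
      GoodChain⇒≤#G : GoodChain p k → k ≤ #G Q
      GoodChain⇒≤#G (ds , length≡k , goods , unique , _) =
        subst (_≤ #G Q) length≡k
              (Unique-⊆⇒length≤ unique λ d∈ → ∈-deduplicate⁺ ℕ._≟_ (All.lookup goods d∈))

#G-lower-bound : ∀ p q Q k → 2 ≤ p → p ≤ q → Coprime p q → IsQ p q Q → F k < p → k ≤ #G Q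
#G-lower-bound p q Q k 2≤p p≤q coprime isQ =
  LowerBound.k≤#G p q {{ℕ.>-nonZero p>0}} {{ℕ.>-nonZero (ℕ.≤-trans p>0 p≤q)}}
                  coprime Q isQ 2≤p p≤q k
  where
  p>0 : 0 < p
  p>0 = ℕ.≤-trans (s≤s z≤n) 2≤p

#G-upper-bound : ∀ p q Q → 0 < p → 0 < q → Coprime p q → IsQ p q Q → #G Q ≤ p ∸ 1
#G-upper-bound p q Q p>0 q>0 coprime isQ =
  GapsOfQ.#G≤p∸1 p q {{ℕ.>-nonZero p>0}} {{ℕ.>-nonZero q>0}} coprime Q isQ

-- 1 − x + x³ − x⁵ + x⁶, with gapset {1, 2}.

Q₃,₄ : Poly
Q₃,₄ = + 1 ∷ ℤ.- + 1 ∷ + 0 ∷ + 1 ∷ + 0 ∷ ℤ.- + 1 ∷ + 1 ∷ []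

IsQ-Q₃,₄ : IsQ 3 4 Q₃,₄
IsQ-Q₃,₄ _ = refl

theorem3 : ((p q k : ℕ) (Q : Poly) → 3 ≤ p → p ≤ q → Coprime p q → IsQ p q Q →
             F k < p → p ≤ F (suc k) →
             (k ≤ #G Q × #G Q ≤ p ∸ 1))
           × (Σ[ p ∈ ℕ ] Σ[ q ∈ ℕ ] Σ[ k ∈ ℕ ] Σ[ Q ∈ Poly ]
                (3 ≤ p × p ≤ q × Coprime p q × IsQ p q Q ×
                 F k < p × p ≤ F (suc k) × #G Q ≡ k))
           × (Σ[ p ∈ ℕ ] Σ[ q ∈ ℕ ] Σ[ Q ∈ Poly ]
                (3 ≤ p × p ≤ q × Coprime p q × IsQ p q Q × #G Q ≡ p ∸ 1))
theorem3 =
  bounds ,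
  (3 , 4 , 2 , Q₃,₄ , ℕ.≤-refl , 3≤4 , coprime-3-4 , IsQ-Q₃,₄ , ℕ.≤-refl , ℕ.≤-refl , refl) ,
  (3 , 4 , Q₃,₄ , ℕ.≤-refl , 3≤4 , coprime-3-4 , IsQ-Q₃,₄ , refl)
  where
  3≤4 : 3 ≤ 4
  3≤4 = ℕ.n≤1+n 3
  coprime-3-4 : Coprime 3 4
  coprime-3-4 = gcd≡1⇒coprime refl
  -- p ≤ F (suc k) only singles out k; the lower bound holds for every k with F k < p.
  bounds : ∀ p q k Q → 3 ≤ p → p ≤ q → Coprime p q → IsQ p q Q → F k < p → p ≤ F (suc k) →
           k ≤ #G Q × #G Q ≤ p ∸ 1
  bounds p q k Q 3≤p p≤q coprime isQ Fk<p _ =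
    #G-lower-bound p q Q k (ℕ.≤-trans (ℕ.n≤1+n 2) 3≤p) p≤q coprime isQ Fk<p ,
    #G-upper-bound p q Q p>0 (ℕ.≤-trans p>0 p≤q) coprime isQ
    where
    p>0 : 0 < p
    p>0 = ℕ.≤-trans (s≤s z≤n) 3≤p
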